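{- Let $G=(V,E)$ be a connected undirected graph with $|V|=n$, $\Phi$ its set of spanning trees (as edge sets), $C_e,c_e\in\mathbb{R}$ for $e\in E$, $k$ an integer in $[0,n-1]$, $L=n-1-k$, and fix $\theta\ge 0$. Consider the linear program \[ \phi(\theta)=\min \sum_{e\in E}C_ex_e+\sum_{e\in E}c_ey_e-\theta\sum_{e\in E}z_e+\theta L \] subject to $\sum_{e\in E}x_e=n-1$; $\sum_{e\in E(U)}x_e\le |U|-1$ for all nonempty $U\subseteq V$; $\sum_{e\in E}y_e=n-1$; $\sum_{e\in E(U)}y_e\le |U|-1$ for all nonempty $U\subseteq V$; $x_e-z_e\ge0$, $y_e-z_e\ge 0$, $x_e,y_e,z_e\ge 0$ for all $e\in E$ (here $E(U)$ is the set of edges with both endpoints in $U$). For $X,Y\in\Phi$, the pair $(X,Y)$ denotes the feasible solution with $x_e=1$ iff $e\in X$, $y_e=1$ iff $e\in Y$, $z_e=1$ iff $e\in X\cap Y$ (other values $0$), and let $E_X=X\setminus Y$, $E_Y=Y\setminus X$. If there exist $\alpha_e\ge0,\beta_e\ge0$ with $\alpha_e+\beta_e=\theta$ for each $e\in E$ such that (i) $X$ is a minimum spanning tree for the costs $C_e-\alpha_e$ and $Y$ is a minimum spanning tree for the costs $c_e-\beta_e$, and (ii) $\alpha_e=0$ for each $e\in E_X$ and $\beta_e=0$ for each $e\in E_Y$, then $(X,Y)$ is an optimal solution to this linear program.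
   Context: Conditions (i)–(ii) (with $\alpha_e+\beta_e=\theta$) are called the sufficient pair optimality conditions for $\theta$. -}

module Defs where

open import Level using (Level; _⊔_) renaming (suc to lsuc)
open import Data.Nat as Nat using (ℕ; zero; suc; _∸_)
open import Data.Fin using (Fin; zero; suc; _≟_)
open import Data.Bool using (Bool; true; false; if_then_else_; _∧_)
open import Data.Product using (Σ; _×_; _,_; proj₁; proj₂; ∃)
open import Data.Sum using (_⊎_)
open import Function using (_∘_)
open import Relation.Nullary using (¬_; does)
open import Relation.Binary using (Rel)
open import Relation.Binary.Structures using (IsTotalOrder)
open import Relation.Binary.PropositionalEquality using (_≡_)
open import Algebra.Bundles using (CommutativeRing)

-- An ordered field (the reals are an instance).  The theorem is stated
-- over an arbitrary ordered field since agda-stdlib has no reals.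

record OrderedField (c ℓ : Level) : Set (lsuc (c ⊔ ℓ)) where
  field
    commRing : CommutativeRing c ℓ
  open CommutativeRing commRing public
  field
    _≤_          : Rel Carrier ℓ
    isTotalOrder : IsTotalOrder _≈_ _≤_
    +-monoʳ-≤    : ∀ {x y} z → x ≤ y → (x + z) ≤ (y + z)
    *-nonneg     : ∀ {x y} → 0# ≤ x → 0# ≤ y → 0# ≤ (x * y)
    0≉1          : ¬ (0# ≈ 1#)
    inverse      : ∀ x → ¬ (x ≈ 0#) → Σ Carrier (λ y → (x * y) ≈ 1#)

  _−_ : Carrier → Carrier → Carrier
  x − y = x + (- y)

-- Undirected (multi)graphs on vertex set Fin n with edge set Fin m;
-- each edge has two endpoints.

Graph : ℕ → ℕ → Set
Graph n m = Fin m → Fin n × Fin n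

ESet : ℕ → Set
ESet m = Fin m → Bool

VSet : ℕ → Set
VSet n = Fin n → Bool

module _ {n m : ℕ} (G : Graph n m) where

  Joins : Fin m → Fin n → Fin n → Set
  Joins e u v = (proj₁ (G e) ≡ u × proj₂ (G e) ≡ v) ⊎ (proj₁ (G e) ≡ v × proj₂ (G e) ≡ u)

  data Reach (S : ESet m) : Fin n → Fin n → Set where
    here : ∀ {u} → Reach S u u
    step : ∀ {u v w} (e : Fin m) → S e ≡ true → Joins e u v → Reach S v w → Reach S u w

  Connects : ESet m → Set
  Connects S = ∀ u v → Reach S u v

  -- G is connected (connected graphs are nonempty)
  Connected : Set
  Connected = (1 Nat.≤ n) × Connects (λ _ → true)

  removeEdge : ESet m → Fin m → ESet m
  removeEdge S e f = if does (f ≟ e) then false else S f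

  -- acyclic: no edge of S lies on a cycle of S, i.e. for every edge of S
  -- its endpoints are not joined by a walk in S without that edge
  Acyclic : ESet m → Set
  Acyclic S = ∀ e → S e ≡ true → ¬ Reach (removeEdge S e) (proj₁ (G e)) (proj₂ (G e))

  IsSpanningTree : ESet m → Set
  IsSpanningTree S = Connects S × Acyclic S

  edgesIn : VSet n → ESet m
  edgesIn U e = U (proj₁ (G e)) ∧ U (proj₂ (G e))

countℕ : ∀ {k} → (Fin k → Bool) → ℕ
countℕ {zero} U = 0
countℕ {suc k} U = (if U zero then 1 else 0) Nat.+ countℕ (U ∘ suc)

NonEmpty : ∀ {k} → (Fin k → Bool) → Set
NonEmpty U = ∃ λ v → U v ≡ true

module _ {c ℓ : Level} (F : OrderedField c ℓ) where
  open OrderedField F using (Carrier; _≈_; _≤_; _+_; _*_; 0#; 1#; _−_)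

  sumF : ∀ {k} → (Fin k → Carrier) → Carrier
  sumF {zero} f = 0#
  sumF {suc k} f = f zero + sumF (f ∘ suc)

  sumOver : ∀ {k} → (Fin k → Bool) → (Fin k → Carrier) → Carrier
  sumOver S f = sumF (λ e → if S e then f e else 0#)

  fromℕ : ℕ → Carrier
  fromℕ zero = 0#
  fromℕ (suc k) = 1# + fromℕ k

  indicator : ∀ {k} → (Fin k → Bool) → Fin k → Carrier
  indicator S e = if S e then 1# else 0#

  module _ {n m : ℕ} (G : Graph n m) where

    TreeConstraints : (Fin m → Carrier) → Set ℓ
    TreeConstraints x =
      (sumF x ≈ fromℕ (n ∸ 1)) ×
      (∀ (U : VSet n) → NonEmpty U → sumOver (edgesIn G U) x ≤ fromℕ (countℕ U ∸ 1))

    Feasible : (x y z : Fin m → Carrier) → Set ℓ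
    Feasible x y z =
      TreeConstraints x × TreeConstraints y ×
      (∀ e → 0# ≤ (x e − z e)) × (∀ e → 0# ≤ (y e − z e)) ×
      (∀ e → 0# ≤ x e) × (∀ e → 0# ≤ y e) × (∀ e → 0# ≤ z e)

    objective : (C c' : Fin m → Carrier) (θ : Carrier) (L : ℕ) (x y z : Fin m → Carrier) → Carrier
    objective C c' θ L x y z =
      ((sumF (λ e → C e * x e) + sumF (λ e → c' e * y e)) − (θ * sumF z)) + (θ * fromℕ L)

    Optimal : (C c' : Fin m → Carrier) (θ : Carrier) (L : ℕ) (x y z : Fin m → Carrier) → Set (c ⊔ ℓ)
    Optimal C c' θ L x y z =
      Feasible x y z ×
      (∀ x' y' z' → Feasible x' y' z' → objective C c' θ L x y z ≤ objective C c' θ L x' y' z')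

    IsMST : (Fin m → Carrier) → ESet m → Set ℓ
    IsMST w X = IsSpanningTree G X × (∀ T → IsSpanningTree G T → sumOver X w ≤ sumOver T w)

-- For spanning trees X, Y and multipliers α + β = θ (α, β ≥ 0) the objective
-- of any feasible (x, y, z) is bounded below by the Lagrangian value
--   Σ (C − α) x + Σ (c' − β) y + θ L,
-- because θ z = α z + β z ≤ α x + β y.  Under condition (ii) the pair (X, Y)
-- attains this value with equality, and by condition (i) together with the
-- fact that no point of the spanning tree polytope is cheaper than a minimum
-- spanning tree, (X, Y) minimises the Lagrangian value.
module Submission where

open import Level using (Level; _⊔_)
open import Data.Nat as Nat using (ℕ; zero; suc; _∸_; z≤n; s≤s)
import Data.Nat.Properties as ℕP
open import Data.Fin using (Fin; zero; suc; _≟_)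
import Data.Fin.Properties as FinP
open import Data.Bool using (Bool; true; false; if_then_else_; _∧_; not)
import Data.Bool
import Data.Bool.Properties as BoolP
open import Data.Product using (Σ; _×_; _,_; proj₁; proj₂; ∃)
open import Data.Sum using (_⊎_; inj₁; inj₂)
open import Data.Empty using (⊥-elim)
open import Data.Unit using (⊤; tt)
open import Data.Maybe using (nothing)
open import Function using (_∘_; id)
open import Relation.Nullary using (does; yes; no)
open import Relation.Nullary.Decidable using (dec-true; dec-false; _×-dec_)
open import Relation.Binary.PropositionalEquality as ≡
  using (_≡_; _≢_; refl; cong; cong₂; subst; subst₂)
open import Relation.Binary.Structures using (IsTotalOrder)
open import Relation.Binary.Bundles using (Poset)
open import Tactic.RingSolver.Core.AlmostCommutativeRing using (fromCommutativeRing)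
import Tactic.RingSolver.NonReflective as RingSolver
import Algebra.Properties.Ring as RingProperties
import Algebra.Properties.Semiring.Sum as SemiringSum
import Relation.Binary.Reasoning.PartialOrder as ≤-Reasoning
import Relation.Binary.Reasoning.Setoid as ≈-Reasoning

open import Defs

false≢true : false ≡ true → ∀ {a} {A : Set a} → A
false≢true ()

module Counting where
  open import Algebra.Properties.CommutativeMonoid.Sum ℕP.+-0-commutativeMonoid public
    using (sum-cong-≗; ∑-distrib-+; ∑-comm; sum-replicate-zero) renaming (sum to sumℕ)

  -- the library's congruence with the length made inferable
  sumℕ-cong : ∀ {k} {f g : Fin k → ℕ} → (∀ i → f i ≡ g i) → sumℕ f ≡ sumℕ g
  sumℕ-cong {k} = sum-cong-≗ {k}

  bit : Bool → ℕ
  bit b = if b then 1 else 0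

  insert : ∀ {k} → Fin k → (Fin k → Bool) → Fin k → Bool
  insert e S v = if does (v ≟ e) then true else S v

  insert-⊇ : ∀ {k} (e : Fin k) (S : Fin k → Bool) v → S v ≡ true → insert e S v ≡ true
  insert-⊇ e S v Sv with v ≟ e
  ... | yes _ = refl
  ... | no _ = Sv

  insert-self : ∀ {k} (e : Fin k) (S : Fin k → Bool) → insert e S e ≡ true
  insert-self e S rewrite dec-true (e ≟ e) refl = refl

  insert-absent : ∀ {k} (e : Fin k) (S : Fin k → Bool) v → insert e S v ≡ false → S v ≡ false
  insert-absent e S v absent with v ≟ e
  ... | yes _ = false≢true (≡.sym absent)
  ... | no _ = absent

  insert-cases : ∀ {k} (e : Fin k) (S : Fin k → Bool) v → insert e S v ≡ true → v ≡ e ⊎ S v ≡ true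
  insert-cases e S v h with v ≟ e
  ... | yes v≡e = inj₁ v≡e
  ... | no _ = inj₂ h

  count-cong : ∀ {k} {U V : Fin k → Bool} → (∀ i → U i ≡ V i) → countℕ U ≡ countℕ V
  count-cong {zero} U≗V = refl
  count-cong {suc k} U≗V = cong₂ Nat._+_ (cong bit (U≗V zero)) (count-cong (U≗V ∘ suc))

  count≡sum : ∀ {k} (U : Fin k → Bool) → countℕ U ≡ sumℕ (bit ∘ U)
  count≡sum {zero} U = refl
  count≡sum {suc k} U = cong (bit (U zero) Nat.+_) (count≡sum (U ∘ suc))

  count-none : ∀ {k} → countℕ {k} (λ _ → false) ≡ 0
  count-none {zero} = refl
  count-none {suc k} = count-none {k}

  count-all : ∀ {k} → countℕ {k} (λ _ → true) ≡ k
  count-all {zero} = refl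
  count-all {suc k} = cong suc (count-all {k})

  count-pos : ∀ {k} (U : Fin k → Bool) v → U v ≡ true → 1 Nat.≤ countℕ U
  count-pos U zero Uv rewrite Uv = s≤s z≤n
  count-pos U (suc v) Uv = ℕP.≤-trans (count-pos (U ∘ suc) v Uv) (ℕP.m≤n+m _ (bit (U zero)))

  count-zero : ∀ {k} (U : Fin k → Bool) → countℕ U ≡ 0 → ∀ v → U v ≡ false
  count-zero U count≡0 v with U v in Uv
  ... | false = refl
  ... | true with subst (1 Nat.≤_) count≡0 (count-pos U v Uv)
  ...   | ()

  count-witness : ∀ {k} (U : Fin k → Bool) {r} → countℕ U ≡ suc r → ∃ λ v → U v ≡ true
  count-witness {zero} U ()
  count-witness {suc k} U h with U zero in U₀
  ... | true = zero , U₀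
  ... | false with count-witness (U ∘ suc) h
  ...   | v , Uv = suc v , Uv

  count-insert : ∀ {k} (e : Fin k) {U V : Fin k → Bool} → U e ≡ false → V e ≡ true →
    (∀ v → v ≢ e → U v ≡ V v) → countℕ V ≡ suc (countℕ U)
  count-insert zero Ue Ve same rewrite Ue | Ve =
    cong suc (count-cong (λ v → ≡.sym (same (suc v) (λ ()))))
  count-insert (suc e) {U} {V} Ue Ve same rewrite same zero (λ ()) =
    ≡.trans (cong (bit (V zero) Nat.+_) (count-insert e Ue Ve (λ v v≢e → same (suc v) (v≢e ∘ FinP.suc-injective))))
            (ℕP.+-suc (bit (V zero)) (countℕ (U ∘ suc)))

  count-insert-new : ∀ {k} (e : Fin k) (S : Fin k → Bool) → S e ≡ false → countℕ (insert e S) ≡ suc (countℕ S)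
  count-insert-new e S Se = count-insert e Se (insert-self e S) same
    where
    same : ∀ v → v ≢ e → S v ≡ insert e S v
    same v v≢e rewrite dec-false (v ≟ e) v≢e = refl

  count-single : ∀ {k} (j : Fin k) → countℕ (λ v → does (v ≟ j)) ≡ 1
  count-single {k} j = ≡.trans (count-insert j {U = λ _ → false} refl (dec-true (j ≟ j) refl) same) (cong suc (count-none {k}))
    where
    same : ∀ v → v ≢ j → false ≡ does (v ≟ j)
    same v v≢j = ≡.sym (dec-false (v ≟ j) v≢j)

  sumℕ-mono : ∀ {k} {f g : Fin k → ℕ} → (∀ i → f i Nat.≤ g i) → sumℕ f Nat.≤ sumℕ g
  sumℕ-mono {zero} f≤g = z≤n
  sumℕ-mono {suc k} f≤g = ℕP.+-mono-≤ (f≤g zero) (sumℕ-mono (f≤g ∘ suc))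

  only drop : ∀ {k} → Fin k → (Fin k → ℕ) → Fin k → ℕ
  only a f j = if does (j ≟ a) then f j else 0
  drop a f j = if does (j ≟ a) then 0 else f j

  sumℕ-only : ∀ {k} (a : Fin k) (f : Fin k → ℕ) → sumℕ (only a f) ≡ f a
  sumℕ-only {suc k} zero f = ≡.trans (cong (f zero Nat.+_) (sum-replicate-zero k)) (ℕP.+-identityʳ (f zero))
  sumℕ-only {suc k} (suc a) f = sumℕ-only a (f ∘ suc)

  sumℕ-pick : ∀ {k} (a : Fin k) (f : Fin k → ℕ) → sumℕ f ≡ f a Nat.+ sumℕ (drop a f)
  sumℕ-pick a f = begin
    sumℕ f                               ≡⟨ sumℕ-cong split ⟩
    sumℕ (λ j → only a f j Nat.+ drop a f j) ≡⟨ ∑-distrib-+ (only a f) (drop a f) ⟩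
    sumℕ (only a f) Nat.+ sumℕ (drop a f)  ≡⟨ cong (Nat._+ sumℕ (drop a f)) (sumℕ-only a f) ⟩
    f a Nat.+ sumℕ (drop a f)            ∎
    where
    open ≡.≡-Reasoning
    split : ∀ j → f j ≡ only a f j Nat.+ drop a f j
    split j with does (j ≟ a)
    ... | true = ≡.sym (ℕP.+-identityʳ (f j))
    ... | false = refl

  sumℕ-∸1 : ∀ {k} (g : Fin k → ℕ) j₀ → 1 Nat.≤ g j₀ → sumℕ (λ j → g j ∸ 1) Nat.≤ sumℕ g ∸ 1
  sumℕ-∸1 g j₀ 1≤g₀ = subst₂ Nat._≤_ (≡.sym (sumℕ-pick j₀ (λ j → g j ∸ 1))) (cong (_∸ 1) (≡.sym (sumℕ-pick j₀ g)))
    (combine (g j₀) 1≤g₀ (sumℕ-mono rest))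
    where
    rest : ∀ j → drop j₀ (λ j → g j ∸ 1) j Nat.≤ drop j₀ g j
    rest j with does (j ≟ j₀)
    ... | true = z≤n
    ... | false = ℕP.m∸n≤m (g j) 1
    combine : ∀ a → 1 Nat.≤ a → ∀ {y z} → y Nat.≤ z → (a ∸ 1) Nat.+ y Nat.≤ (a Nat.+ z) ∸ 1
    combine (suc a) _ y≤z = ℕP.+-monoʳ-≤ a y≤z

-- Kruskal's algorithm
-- tracks the components of its forest by such a labelling; the excess of a
-- labelling, Σ over classes of (size − 1), equals n minus the number of
-- classes and is the number of edges of a spanning forest with these
-- components.
module Labellings {n : ℕ} where
  open Counting

  classSize : (Fin n → Fin n) → Fin n → ℕ
  classSize ℓ j = countℕ (λ v → does (ℓ v ≟ j))

  excess : (Fin n → Fin n) → ℕ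
  excess ℓ = sumℕ (λ j → classSize ℓ j ∸ 1)

  -- all classes of the identity labelling are singletons
  excess-id : excess id ≡ 0
  excess-id = ≡.trans (sumℕ-cong {n} (λ j → cong (_∸ 1) (count-single j))) (sum-replicate-zero n)

  -- a constant labelling has a single class
  excess-const : ∀ ℓ c₀ → (∀ v → ℓ v ≡ c₀) → excess ℓ ≡ n ∸ 1
  excess-const ℓ c₀ ℓ≡c₀ = ≡.trans (sumℕ-cong pointwise) (sumℕ-only c₀ (λ _ → n ∸ 1))
    where
    pointwise : ∀ j → classSize ℓ j ∸ 1 ≡ only c₀ (λ _ → n ∸ 1) j
    pointwise j with j ≟ c₀
    ... | yes refl = cong (_∸ 1) (≡.trans (count-cong (λ v → ≡.trans (cong (λ l → does (l ≟ j)) (ℓ≡c₀ v)) (dec-true (j ≟ j) refl)))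
                                          (count-all {n}))
    ... | no j≢c₀ = cong (_∸ 1) (≡.trans (count-cong (λ v → ≡.trans (cong (λ l → does (l ≟ j)) (ℓ≡c₀ v))
                                                                    (dec-false (c₀ ≟ j) (j≢c₀ ∘ ≡.sym))))
                                         (count-none {n}))

  relabel : Fin n → Fin n → Fin n → Fin n
  relabel a b j = if does (j ≟ b) then a else j

  relabel-a : ∀ a b → relabel a b a ≡ a
  relabel-a a b with a ≟ b
  ... | yes _ = refl
  ... | no _ = refl

  relabel-b : ∀ a b → relabel a b b ≡ a
  relabel-b a b rewrite dec-true (b ≟ b) refl = refl

  relabel-≡ : ∀ a b x y → relabel a b x ≡ relabel a b y → x ≡ y ⊎ ((x ≡ b × y ≡ a) ⊎ (x ≡ a × y ≡ b))
  relabel-≡ a b x y eq with x ≟ b | y ≟ b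
  ... | yes x≡b | yes y≡b = inj₁ (≡.trans x≡b (≡.sym y≡b))
  ... | yes x≡b | no _ = inj₂ (inj₁ (x≡b , ≡.sym eq))
  ... | no _ | yes y≡b = inj₂ (inj₂ (eq , y≡b))
  ... | no _ | no _ = inj₁ eq

  module Merge (ℓ : Fin n → Fin n) (a b : Fin n) (a≢b : a ≢ b) where
    ℓ' : Fin n → Fin n
    ℓ' = relabel a b ∘ ℓ

    size-a : classSize ℓ' a ≡ classSize ℓ a Nat.+ classSize ℓ b
    size-a = begin
      countℕ (λ v → does (ℓ' v ≟ a))                  ≡⟨ count≡sum (λ v → does (ℓ' v ≟ a)) ⟩
      sumℕ (λ v → bit (does (ℓ' v ≟ a)))              ≡⟨ sumℕ-cong (λ v → pointwise (ℓ v)) ⟩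
      sumℕ (λ v → in-a v Nat.+ in-b v)                ≡⟨ ∑-distrib-+ in-a in-b ⟩
      sumℕ in-a Nat.+ sumℕ in-b                       ≡⟨ cong₂ Nat._+_ (count≡sum (λ v → does (ℓ v ≟ a))) (count≡sum (λ v → does (ℓ v ≟ b))) ⟨
      classSize ℓ a Nat.+ classSize ℓ b               ∎
      where
      open ≡.≡-Reasoning
      in-a in-b : Fin n → ℕ
      in-a v = bit (does (ℓ v ≟ a))
      in-b v = bit (does (ℓ v ≟ b))
      pointwise : ∀ x → bit (does (relabel a b x ≟ a)) ≡ bit (does (x ≟ a)) Nat.+ bit (does (x ≟ b))
      pointwise x with x ≟ b
      ... | yes refl rewrite dec-true (a ≟ a) refl | dec-false (x ≟ a) (a≢b ∘ ≡.sym) = refl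
      ... | no _ = ≡.sym (ℕP.+-identityʳ _)

    size-b : classSize ℓ' b ≡ 0
    size-b = ≡.trans (count-cong (λ v → pointwise (ℓ v))) (count-none {n})
      where
      pointwise : ∀ x → does (relabel a b x ≟ b) ≡ false
      pointwise x with x ≟ b
      ... | yes _ = dec-false (a ≟ b) a≢b
      ... | no x≢b = dec-false (x ≟ b) x≢b

    size-other : ∀ j → j ≢ a → j ≢ b → classSize ℓ' j ≡ classSize ℓ j
    size-other j j≢a j≢b = count-cong (λ v → pointwise (ℓ v))
      where
      pointwise : ∀ x → does (relabel a b x ≟ j) ≡ does (x ≟ j)
      pointwise x with x ≟ b
      ... | yes refl rewrite dec-false (a ≟ j) (j≢a ∘ ≡.sym) | dec-false (x ≟ j) (j≢b ∘ ≡.sym) = refl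
      ... | no _ = refl

    pick₂ : ∀ (f : Fin n → ℕ) → sumℕ f ≡ f a Nat.+ (f b Nat.+ sumℕ (drop b (drop a f)))
    pick₂ f = ≡.trans (sumℕ-pick a f) (cong (f a Nat.+_) (≡.trans (sumℕ-pick b (drop a f))
      (cong (Nat._+ sumℕ (drop b (drop a f))) drop-a-at-b)))
      where
      drop-a-at-b : drop a f b ≡ f b
      drop-a-at-b rewrite dec-false (b ≟ a) (a≢b ∘ ≡.sym) = refl

    rest-equal : ∀ j → drop b (drop a (λ i → classSize ℓ' i ∸ 1)) j ≡ drop b (drop a (λ i → classSize ℓ i ∸ 1)) j
    rest-equal j with j ≟ b
    ... | yes _ = refl
    ... | no j≢b with j ≟ a
    ...   | yes _ = refl
    ...   | no j≢a = cong (_∸ 1) (size-other j j≢a j≢b)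

    arithmetic : ∀ p q r → 1 Nat.≤ p → 1 Nat.≤ q → ((p Nat.+ q) ∸ 1) Nat.+ (0 Nat.+ r) ≡ suc ((p ∸ 1) Nat.+ ((q ∸ 1) Nat.+ r))
    arithmetic (suc p) (suc q) r _ _ = ≡.trans (cong (Nat._+ r) (ℕP.+-suc p q)) (cong suc (ℕP.+-assoc p q r))

    excess-merge : 1 Nat.≤ classSize ℓ a → 1 Nat.≤ classSize ℓ b → excess ℓ' ≡ suc (excess ℓ)
    excess-merge 1≤a 1≤b = begin
      excess ℓ'
        ≡⟨ pick₂ _ ⟩
      (classSize ℓ' a ∸ 1) Nat.+ ((classSize ℓ' b ∸ 1) Nat.+ sumℕ (drop b (drop a (λ i → classSize ℓ' i ∸ 1))))
        ≡⟨ cong₂ Nat._+_ (cong (_∸ 1) size-a) (cong₂ Nat._+_ (cong (_∸ 1) size-b) (sumℕ-cong rest-equal)) ⟩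
      ((classSize ℓ a Nat.+ classSize ℓ b) ∸ 1) Nat.+ (0 Nat.+ sumℕ (drop b (drop a (λ i → classSize ℓ i ∸ 1))))
        ≡⟨ arithmetic _ _ _ 1≤a 1≤b ⟩
      suc ((classSize ℓ a ∸ 1) Nat.+ ((classSize ℓ b ∸ 1) Nat.+ sumℕ (drop b (drop a (λ i → classSize ℓ i ∸ 1)))))
        ≡⟨ cong suc (pick₂ _) ⟨
      suc (excess ℓ) ∎
      where open ≡.≡-Reasoning

  open Merge public using (excess-merge)

  -- If every vertex outside the nonempty set U is alone in its class, the
  -- excess is at most |U| − 1: only the classes' parts inside U count.
  module _ (ℓ : Fin n → Fin n) (U : Fin n → Bool) where
    classSizeIn : Fin n → ℕ
    classSizeIn j = countℕ (λ v → U v ∧ does (ℓ v ≟ j))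

    sum-classSizeIn : sumℕ classSizeIn ≡ countℕ U
    sum-classSizeIn = begin
      sumℕ classSizeIn                                  ≡⟨ sumℕ-cong (λ j → count≡sum (λ v → U v ∧ does (ℓ v ≟ j))) ⟩
      sumℕ (λ j → sumℕ (λ v → bit (U v ∧ does (ℓ v ≟ j)))) ≡⟨ ∑-comm (λ j v → bit (U v ∧ does (ℓ v ≟ j))) ⟩
      sumℕ (λ v → sumℕ (λ j → bit (U v ∧ does (ℓ v ≟ j)))) ≡⟨ sumℕ-cong (λ v → ≡.trans (sumℕ-cong (pointwise v)) (sumℕ-only (ℓ v) _)) ⟩
      sumℕ (λ v → bit (U v))                            ≡⟨ count≡sum U ⟨
      countℕ U                                          ∎
      where
      open ≡.≡-Reasoning
      pointwise : ∀ v j → bit (U v ∧ does (ℓ v ≟ j)) ≡ only (ℓ v) (λ _ → bit (U v)) j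
      pointwise v j with j ≟ ℓ v
      ... | yes refl rewrite dec-true (ℓ v ≟ ℓ v) refl = cong bit (BoolP.∧-identityʳ (U v))
      ... | no j≢ℓv rewrite dec-false (ℓ v ≟ j) (j≢ℓv ∘ ≡.sym) with U v
      ...   | true = refl
      ...   | false = refl

    excess-≤ : ∀ u₀ → U u₀ ≡ true → (∀ v → U v ≡ false → ∀ u → ℓ u ≡ ℓ v → u ≡ v) →
      excess ℓ Nat.≤ countℕ U ∸ 1
    excess-≤ u₀ Uu₀ outside-alone = begin
      excess ℓ                      ≤⟨ sumℕ-mono pointwise ⟩
      sumℕ (λ j → classSizeIn j ∸ 1) ≤⟨ sumℕ-∸1 classSizeIn (ℓ u₀) (count-pos _ u₀ u₀-counted) ⟩
      sumℕ classSizeIn ∸ 1           ≡⟨ cong (_∸ 1) sum-classSizeIn ⟩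
      countℕ U ∸ 1                   ∎
      where
      open ℕP.≤-Reasoning
      u₀-counted : (U u₀ ∧ does (ℓ u₀ ≟ ℓ u₀)) ≡ true
      u₀-counted rewrite Uu₀ | dec-true (ℓ u₀ ≟ ℓ u₀) refl = refl
      -- a class meeting the complement of U is a singleton; otherwise it lies in U
      pointwise : ∀ j → classSize ℓ j ∸ 1 Nat.≤ classSizeIn j ∸ 1
      pointwise j with FinP.any? (λ v → (U v Data.Bool.≟ false) ×-dec (ℓ v ≟ j))
      ... | yes (v , Uv , ℓv≡j) = subst (λ s → s ∸ 1 Nat.≤ classSizeIn j ∸ 1) (≡.sym singleton) z≤n
        where
        is-v : ∀ u → does (ℓ u ≟ j) ≡ does (u ≟ v)
        is-v u with u ≟ v
        ... | yes refl = dec-true (ℓ u ≟ j) ℓv≡j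
        ... | no u≢v = dec-false (ℓ u ≟ j) (λ ℓu≡j → u≢v (outside-alone v Uv u (≡.trans ℓu≡j (≡.sym ℓv≡j))))
        singleton : classSize ℓ j ≡ 1
        singleton = ≡.trans (count-cong is-v) (count-single v)
      ... | no none-outside = ℕP.≤-reflexive (cong (_∸ 1) (count-cong inside))
        where
        inside : ∀ v → does (ℓ v ≟ j) ≡ (U v ∧ does (ℓ v ≟ j))
        inside v with U v in Uv
        ... | true = refl
        ... | false with ℓ v ≟ j
        ...   | yes ℓv≡j = ⊥-elim (none-outside (v , Uv , ℓv≡j))
        ...   | no _ = refl

module OrderedFieldProperties {c l : Level} (𝔽 : OrderedField c l) where
  open OrderedField 𝔽 public hiding (zero) renaming (refl to ≈-refl)
  open RingProperties ring public using (-‿distribˡ-*; -‿distribʳ-*; -‿involutive; -1*x≈-x; -0#≈0#)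
  open IsTotalOrder isTotalOrder public using (total)
    renaming (refl to ≤-refl; reflexive to ≤-reflexive; trans to ≤-trans; ≤-respˡ-≈ to ≤-respˡ; ≤-respʳ-≈ to ≤-respʳ)

  poset : Poset c l l
  poset = record { isPartialOrder = IsTotalOrder.isPartialOrder isTotalOrder }

  module Solver = RingSolver (fromCommutativeRing commRing (λ _ → nothing))
  open Solver using (solve; _⊜_; _⊕_; _⊗_; ⊝_)

  ≡⇒≈ : ∀ {a b : Carrier} → a ≡ b → a ≈ b
  ≡⇒≈ refl = ≈-refl

  +-mono-≤ : ∀ {a b x y} → a ≤ b → x ≤ y → (a + x) ≤ (b + y)
  +-mono-≤ {a} {b} {x} {y} a≤b x≤y =
    ≤-trans (+-monoʳ-≤ x a≤b) (≤-respˡ (+-comm x b) (≤-respʳ (+-comm y b) (+-monoʳ-≤ b x≤y)))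

  +-monoˡ-≤ : ∀ z {x y} → x ≤ y → (z + x) ≤ (z + y)
  +-monoˡ-≤ z = +-mono-≤ ≤-refl

  +-−-cancel : ∀ y z → ((y + z) + (- z)) ≈ y
  +-−-cancel y z = trans (+-assoc y z (- z)) (trans (+-congˡ (-‿inverseʳ z)) (+-identityʳ y))

  +-cancelʳ-≤ : ∀ {a b} z → (a + z) ≤ (b + z) → a ≤ b
  +-cancelʳ-≤ {a} {b} z h = ≤-respˡ (+-−-cancel a z) (≤-respʳ (+-−-cancel b z) (+-monoʳ-≤ (- z) h))

  x≤y⇒0≤y−x : ∀ {x y} → x ≤ y → 0# ≤ (y − x)
  x≤y⇒0≤y−x {x} p = ≤-respˡ (-‿inverseʳ x) (+-monoʳ-≤ (- x) p)

  0≤y−x⇒x≤y : ∀ {x y} → 0# ≤ (y − x) → x ≤ y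
  0≤y−x⇒x≤y {x} {y} p = ≤-respˡ (+-identityˡ x) (≤-respʳ y−x+x≈y (+-monoʳ-≤ x p))
    where
    y−x+x≈y : ((y − x) + x) ≈ y
    y−x+x≈y = trans (+-assoc y (- x) x) (trans (+-congˡ (-‿inverseˡ x)) (+-identityʳ y))

  -‿antitone : ∀ {u v} → u ≤ v → (- v) ≤ (- u)
  -‿antitone {u} {v} u≤v = ≤-respˡ (cancel u v) (≤-respʳ (trans (+-congˡ (+-comm (- u) (- v))) (cancel v u))
    (+-monoʳ-≤ ((- u) + (- v)) u≤v))
    where
    cancel : ∀ u v → (u + ((- u) + (- v))) ≈ (- v)
    cancel u v = trans (sym (+-assoc u (- u) (- v))) (trans (+-congʳ (-‿inverseʳ u)) (+-identityˡ (- v)))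

  *-monoˡ-≤ : ∀ {a x y} → 0# ≤ a → x ≤ y → (a * x) ≤ (a * y)
  *-monoˡ-≤ {a} {x} {y} 0≤a x≤y = 0≤y−x⇒x≤y (≤-respʳ a[y−x]≈ay−ax (*-nonneg 0≤a (x≤y⇒0≤y−x x≤y)))
    where
    a[y−x]≈ay−ax : (a * (y − x)) ≈ ((a * y) − (a * x))
    a[y−x]≈ay−ax = trans (distribˡ a y (- x)) (+-congˡ (sym (-‿distribʳ-* a x)))

  -- 1 = (−1)·(−1) is a square, hence nonnegative.
  0≤1 : 0# ≤ 1#
  0≤1 with total 0# 1#
  ... | inj₁ 0≤1 = 0≤1
  ... | inj₂ 1≤0 = ≤-respʳ (trans (-1*x≈-x (- 1#)) (-‿involutive 1#)) (*-nonneg 0≤-1 0≤-1)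
    where
    0≤-1 : 0# ≤ (- 1#)
    0≤-1 = ≤-respˡ (-‿inverseʳ 1#) (≤-respʳ (+-identityˡ (- 1#)) (+-monoʳ-≤ (- 1#) 1≤0))

  0≤fromℕ : ∀ k → 0# ≤ fromℕ 𝔽 k
  0≤fromℕ zero = ≤-refl
  0≤fromℕ (suc k) = ≤-respˡ (+-identityˡ 0#) (+-mono-≤ 0≤1 (0≤fromℕ k))

  fromℕ-+ : ∀ a b → fromℕ 𝔽 (a Nat.+ b) ≈ (fromℕ 𝔽 a + fromℕ 𝔽 b)
  fromℕ-+ zero b = sym (+-identityˡ _)
  fromℕ-+ (suc a) b = trans (+-congˡ (fromℕ-+ a b)) (sym (+-assoc 1# _ _))

  fromℕ-mono : ∀ {a b} → a Nat.≤ b → fromℕ 𝔽 a ≤ fromℕ 𝔽 b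
  fromℕ-mono {b = b} z≤n = 0≤fromℕ b
  fromℕ-mono (s≤s a≤b) = +-monoˡ-≤ 1# (fromℕ-mono a≤b)

  -- An inequality  A + k s ≤ B + k t  survives enlarging the multiplier k to
  -- M ≥ k, provided s ≤ t.  This drives the greedy (Kruskal) bound below.
  raise-multiplier : ∀ A B k s t M → (A + (k * s)) ≤ (B + (k * t)) → s ≤ t → k ≤ M →
                     (A + (M * s)) ≤ (B + (M * t))
  raise-multiplier A B k s t M hyp s≤t k≤M = begin
    A + M * s                  ≈⟨ split A s ⟩
    (A + k * s) + (M − k) * s  ≤⟨ +-mono-≤ hyp (*-monoˡ-≤ (x≤y⇒0≤y−x k≤M) s≤t) ⟩
    (B + k * t) + (M − k) * t  ≈⟨ split B t ⟨
    B + M * t                  ∎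
    where
    open ≤-Reasoning poset
    M≈k+[M−k] : M ≈ (k + (M − k))
    M≈k+[M−k] = sym (trans (+-congˡ (+-comm M (- k)))
      (trans (sym (+-assoc k (- k) M)) (trans (+-congʳ (-‿inverseʳ k)) (+-identityˡ M))))
    split : ∀ X u → (X + (M * u)) ≈ ((X + (k * u)) + ((M − k) * u))
    split X u = trans (+-congˡ (*-congʳ M≈k+[M−k]))
      (solve 4 (λ X k d u → (X ⊕ ((k ⊕ d) ⊗ u)) ⊜ ((X ⊕ (k ⊗ u)) ⊕ (d ⊗ u))) ≈-refl X k (M − k) u)

  upper-bound : ∀ {k} (w : Fin k → Carrier) → Σ Carrier (λ M → ∀ e → w e ≤ M)
  upper-bound {zero} w = 0# , λ ()
  upper-bound {suc k} w with upper-bound (w ∘ suc)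
  ... | M , w≤M with total (w zero) M
  ...   | inj₁ w₀≤M = M , λ { zero → w₀≤M ; (suc e) → w≤M e }
  ...   | inj₂ M≤w₀ = w zero , λ { zero → ≤-refl ; (suc e) → ≤-trans (w≤M e) M≤w₀ }

  minimum-on : ∀ {k} (w : Fin k → Carrier) (Q : Fin k → Bool) →
    (∀ e → Q e ≡ false) ⊎ Σ (Fin k) (λ e → Q e ≡ true × (∀ e' → Q e' ≡ true → w e ≤ w e'))
  minimum-on {zero} w Q = inj₁ (λ ())
  minimum-on {suc k} w Q with Q zero in eq | minimum-on (w ∘ suc) (Q ∘ suc)
  ... | false | inj₁ none = inj₁ λ { zero → eq ; (suc e) → none e }
  ... | false | inj₂ (e , qe , min) =
    inj₂ (suc e , qe , λ { zero q → false≢true (≡.trans (≡.sym eq) q) ; (suc e') q → min e' q })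
  ... | true | inj₁ none =
    inj₂ (zero , eq , λ { zero _ → ≤-refl ; (suc e') q → false≢true (≡.trans (≡.sym (none e')) q) })
  ... | true | inj₂ (e , qe , min) with total (w zero) (w (suc e))
  ...   | inj₁ w₀≤ = inj₂ (zero , eq , λ { zero _ → ≤-refl ; (suc e') q → ≤-trans w₀≤ (min e' q) })
  ...   | inj₂ ≤w₀ = inj₂ (suc e , qe , λ { zero _ → ≤w₀ ; (suc e') q → min e' q })

  -- Finite sums.  The summation sumF of Defs unfolds exactly like the
  -- library's sum over the additive monoid, so the library identities for
  -- the latter transfer to it.

  open SemiringSum semiring using (sum; sum-cong-≋; ∑-distrib-+; ∑-comm; sum-replicate-zero; *-distribˡ-sum)
  open Counting using (sumℕ; insert)

  ΣF : ∀ {k} → (Fin k → Carrier) → Carrier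
  ΣF = sumF 𝔽

  ΣF≡sum : ∀ {k} (f : Fin k → Carrier) → ΣF f ≡ sum f
  ΣF≡sum {zero} f = refl
  ΣF≡sum {suc k} f = cong (f zero +_) (ΣF≡sum (f ∘ suc))

  sumF-cong : ∀ {k} {f g : Fin k → Carrier} → (∀ i → f i ≈ g i) → ΣF f ≈ ΣF g
  sumF-cong {f = f} {g} f≈g rewrite ΣF≡sum f | ΣF≡sum g = sum-cong-≋ f≈g

  sumF-zero : ∀ {k} {f : Fin k → Carrier} → (∀ i → f i ≈ 0#) → ΣF f ≈ 0#
  sumF-zero {k} f≈0 = trans (sumF-cong f≈0) (trans (≡⇒≈ (ΣF≡sum {k} (λ _ → 0#))) (sum-replicate-zero k))

  sumF-+ : ∀ {k} (f g : Fin k → Carrier) → ΣF (λ i → f i + g i) ≈ (ΣF f + ΣF g)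
  sumF-+ f g rewrite ΣF≡sum f | ΣF≡sum g | ΣF≡sum (λ i → f i + g i) = ∑-distrib-+ f g

  sumF-scale : ∀ {k} a (f : Fin k → Carrier) → ΣF (λ i → a * f i) ≈ (a * ΣF f)
  sumF-scale a f rewrite ΣF≡sum f | ΣF≡sum (λ i → a * f i) = sym (*-distribˡ-sum a f)

  sumF-swap : ∀ {k r} (f : Fin k → Fin r → Carrier) →
    ΣF (λ i → ΣF (λ j → f i j)) ≈ ΣF (λ j → ΣF (λ i → f i j))
  sumF-swap f = begin
    ΣF (λ i → ΣF (f i))               ≈⟨ sumF-cong (λ i → ≡⇒≈ (ΣF≡sum (f i))) ⟩
    ΣF (λ i → sum (f i))              ≡⟨ ΣF≡sum (λ i → sum (f i)) ⟩
    sum (λ i → sum (f i))             ≈⟨ ∑-comm f ⟩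
    sum (λ j → sum (λ i → f i j))     ≡⟨ ΣF≡sum (λ j → sum (λ i → f i j)) ⟨
    ΣF (λ j → sum (λ i → f i j))      ≈⟨ sumF-cong (λ j → ≡⇒≈ (ΣF≡sum (λ i → f i j))) ⟨
    ΣF (λ j → ΣF (λ i → f i j))       ∎
    where open ≈-Reasoning setoid

  sumF-neg : ∀ {k} (f : Fin k → Carrier) → ΣF (λ i → - f i) ≈ (- ΣF f)
  sumF-neg {zero} f = sym -0#≈0#
  sumF-neg {suc k} f = trans (+-congˡ (sumF-neg (f ∘ suc)))
    (solve 2 (λ a b → ((⊝ a) ⊕ (⊝ b)) ⊜ (⊝ (a ⊕ b))) ≈-refl (f zero) (ΣF (f ∘ suc)))

  sumF-mono : ∀ {k} {f g : Fin k → Carrier} → (∀ i → f i ≤ g i) → ΣF f ≤ ΣF g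
  sumF-mono {zero} f≤g = ≤-refl
  sumF-mono {suc k} f≤g = +-mono-≤ (f≤g zero) (sumF-mono (f≤g ∘ suc))

  sumF-only : ∀ {k} (a : Fin k) (f : Fin k → Carrier) → ΣF (λ j → if does (j ≟ a) then f j else 0#) ≈ f a
  sumF-only {suc k} zero f = trans (+-congˡ (sumF-zero {k} (λ _ → ≈-refl))) (+-identityʳ (f zero))
  sumF-only {suc k} (suc a) f = trans (+-identityˡ _) (sumF-only a (f ∘ suc))

  sumF-fromℕ : ∀ {k} (g : Fin k → ℕ) → ΣF (λ j → fromℕ 𝔽 (g j)) ≈ fromℕ 𝔽 (sumℕ g)
  sumF-fromℕ {zero} g = ≈-refl
  sumF-fromℕ {suc k} g = trans (+-congˡ (sumF-fromℕ (g ∘ suc))) (sym (fromℕ-+ (g zero) _))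

  sumF-indicator : ∀ {k} (B : Fin k → Bool) → ΣF (indicator 𝔽 B) ≈ fromℕ 𝔽 (countℕ B)
  sumF-indicator {zero} B = ≈-refl
  sumF-indicator {suc k} B with B zero
  ... | true = +-congˡ (sumF-indicator (B ∘ suc))
  ... | false = trans (+-identityˡ _) (sumF-indicator (B ∘ suc))

  sumOver-insert : ∀ {k} e (S : Fin k → Bool) (f : Fin k → Carrier) → S e ≡ false →
    sumOver 𝔽 (insert e S) f ≈ (sumOver 𝔽 S f + f e)
  sumOver-insert {k} e S f Se = trans (sumF-cong split) (trans (sumF-+ on-S at-e) (+-congˡ (sumF-only e f)))
    where
    on-S at-e : Fin k → Carrier
    on-S v = if S v then f v else 0#
    at-e v = if does (v ≟ e) then f v else 0#
    split : ∀ v → (if insert e S v then f v else 0#) ≈ (on-S v + at-e v)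
    split v with v ≟ e
    ... | yes refl rewrite Se = sym (+-identityˡ _)
    ... | no _ = sym (+-identityʳ _)

  sumF-weighted-indicator : ∀ {k} (S : Fin k → Bool) (w : Fin k → Carrier) →
    ΣF (λ e → w e * indicator 𝔽 S e) ≈ sumOver 𝔽 S w
  sumF-weighted-indicator S w = sumF-cong pointwise
    where
    pointwise : ∀ e → (w e * indicator 𝔽 S e) ≈ (if S e then w e else 0#)
    pointwise e with S e
    ... | true = *-identityʳ (w e)
    ... | false = zeroʳ (w e)

  sumOver-empty : ∀ {k} (f : Fin k → Carrier) → sumOver 𝔽 (λ _ → false) f ≈ 0#
  sumOver-empty {k} f = sumF-zero {k} (λ _ → ≈-refl)

  sumOver-full : ∀ {k} (S : Fin k → Bool) (f : Fin k → Carrier) → (∀ e → S e ≡ true) → sumOver 𝔽 S f ≈ ΣF f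
  sumOver-full S f all = sumF-cong pointwise
    where
    pointwise : ∀ e → (if S e then f e else 0#) ≈ f e
    pointwise e rewrite all e = ≈-refl

module Kruskal {n m : ℕ} (G : Graph n m) where
  open Counting
  open Labellings

  src tgt : Fin m → Fin n
  src e = proj₁ (G e)
  tgt e = proj₂ (G e)

  Reach-mono : ∀ {S S' : ESet m} → (∀ e → S e ≡ true → S' e ≡ true) → ∀ {u v} → Reach G S u v → Reach G S' u v
  Reach-mono S⊆S' here = here
  Reach-mono S⊆S' (step e Se joins walk) = step e (S⊆S' e Se) joins (Reach-mono S⊆S' walk)

  Reach-trans : ∀ {S u v w} → Reach G S u v → Reach G S v w → Reach G S u w
  Reach-trans here walk' = walk'
  Reach-trans (step e Se joins walk) walk' = step e Se joins (Reach-trans walk walk')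

  label-constant : ∀ {S} (ℓ : Fin n → Fin n) → (∀ e → S e ≡ true → ℓ (src e) ≡ ℓ (tgt e)) →
    ∀ {u v} → Reach G S u v → ℓ u ≡ ℓ v
  label-constant ℓ ℓ-const here = refl
  label-constant ℓ ℓ-const (step e Se (inj₁ (src≡u , tgt≡v)) walk) =
    ≡.trans (cong ℓ (≡.sym src≡u)) (≡.trans (ℓ-const e Se) (≡.trans (cong ℓ tgt≡v) (label-constant ℓ ℓ-const walk)))
  label-constant ℓ ℓ-const (step e Se (inj₂ (src≡v , tgt≡u)) walk) =
    ≡.trans (cong ℓ (≡.sym tgt≡u)) (≡.trans (≡.sym (ℓ-const e Se)) (≡.trans (cong ℓ src≡v) (label-constant ℓ ℓ-const walk)))

  walk-from-outside : ∀ {S : ESet m} {U : VSet n} → (∀ e → S e ≡ true → edgesIn G U e ≡ true) →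
    ∀ {v u} → U v ≡ false → Reach G S v u → v ≡ u
  walk-from-outside S⊆E[U] Uv here = refl
  walk-from-outside {U = U} S⊆E[U] Uv (step e Se (inj₁ (src≡v , _)) _)
    with U (src e) in Usrc | S⊆E[U] e Se
  ... | true | _ = false≢true (≡.trans (≡.sym Uv) (subst (λ x → U x ≡ true) src≡v Usrc))
  walk-from-outside {U = U} S⊆E[U] Uv (step e Se (inj₂ (_ , tgt≡v)) _)
    with U (src e) | U (tgt e) in Utgt | S⊆E[U] e Se
  ... | true | true | _ = false≢true (≡.trans (≡.sym Uv) (subst (λ x → U x ≡ true) tgt≡v Utgt))

  removeEdge-≢ : ∀ (S : ESet m) f g → removeEdge G S f g ≡ true → g ≢ f
  removeEdge-≢ S f g g∈ with g ≟ f
  ... | yes _ = false≢true g∈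
  ... | no g≢f = g≢f

  removeEdge-⊆ : ∀ (S : ESet m) f g → removeEdge G S f g ≡ true → S g ≡ true
  removeEdge-⊆ S f g g∈ with g ≟ f
  ... | yes _ = false≢true g∈
  ... | no _ = g∈

  module _ (F : ESet m) (e f : Fin m) where
    private
      R : ESet m
      R = removeEdge G F f

    Through : Fin n → Fin n → Set
    Through u v = Reach G R u v ⊎ ((Reach G R u (src e) × Reach G R (tgt e) v)
                                 ⊎ (Reach G R u (tgt e) × Reach G R (src e) v))

    private
      along-e : ∀ {u w v} → Joins G e u w → Through w v → Through u v
      along-e (inj₁ (refl , refl)) (inj₁ rest) = inj₂ (inj₁ (here , rest))
      along-e (inj₁ (refl , refl)) (inj₂ (inj₁ (_ , rest))) = inj₂ (inj₁ (here , rest))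
      along-e (inj₁ (refl , refl)) (inj₂ (inj₂ (_ , rest))) = inj₁ rest
      along-e (inj₂ (refl , refl)) (inj₁ rest) = inj₂ (inj₂ (here , rest))
      along-e (inj₂ (refl , refl)) (inj₂ (inj₁ (_ , rest))) = inj₁ rest
      along-e (inj₂ (refl , refl)) (inj₂ (inj₂ (_ , rest))) = inj₂ (inj₂ (here , rest))

      edge-cases : ∀ g → removeEdge G (insert e F) f g ≡ true → g ≡ e ⊎ R g ≡ true
      edge-cases g g∈ with g ≟ f
      ... | yes _ = false≢true g∈
      ... | no _ = insert-cases e F g g∈

    walk-through : ∀ {u v} → Reach G (removeEdge G (insert e F) f) u v → Through u v
    walk-through here = inj₁ here
    walk-through (step g g∈ joins walk) with edge-cases g g∈ | walk-through walk
    ... | inj₁ refl | rest = along-e joins rest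
    ... | inj₂ Rg | inj₁ rest = inj₁ (step g Rg joins rest)
    ... | inj₂ Rg | inj₂ (inj₁ (to , from)) = inj₂ (inj₁ (step g Rg joins to , from))
    ... | inj₂ Rg | inj₂ (inj₂ (to , from)) = inj₂ (inj₂ (step g Rg joins to , from))

  acyclic-insert : ∀ F e (ℓ : Fin n → Fin n) → (∀ f → F f ≡ true → ℓ (src f) ≡ ℓ (tgt f)) →
    ℓ (src e) ≢ ℓ (tgt e) → Acyclic G F → Acyclic G (insert e F)
  acyclic-insert F e ℓ ℓ-const separated acyclic f f∈ walk with insert-cases e F f f∈
  ... | inj₁ refl = separated (label-constant ℓ (λ g g∈ → ℓ-const g (in-F g g∈)) walk)
    where
    in-F : ∀ g → removeEdge G (insert e F) e g ≡ true → F g ≡ true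
    in-F g g∈ with insert-cases e F g (removeEdge-⊆ (insert e F) e g g∈)
    ... | inj₁ g≡e = ⊥-elim (removeEdge-≢ (insert e F) e g g∈ g≡e)
    ... | inj₂ Fg = Fg
  ... | inj₂ Ff with walk-through F e f walk
  ...   | inj₁ avoiding = acyclic f Ff avoiding
  ...   | inj₂ (inj₁ (to-src , from-tgt)) =
    separated (≡.trans (≡.sym (along to-src)) (≡.trans (ℓ-const f Ff) (≡.sym (along from-tgt))))
    where
    along : ∀ {u v} → Reach G (removeEdge G F f) u v → ℓ u ≡ ℓ v
    along = label-constant ℓ (λ g g∈ → ℓ-const g (removeEdge-⊆ F f g g∈))
  ...   | inj₂ (inj₂ (to-tgt , from-src)) =
    separated (≡.trans (along from-src) (≡.trans (≡.sym (ℓ-const f Ff)) (along to-tgt)))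
    where
    along : ∀ {u v} → Reach G (removeEdge G F f) u v → ℓ u ≡ ℓ v
    along = label-constant ℓ (λ g g∈ → ℓ-const g (removeEdge-⊆ F f g g∈))

  -- The state of the algorithm: the edges examined so far, the accepted
  -- forest, and a labelling of the vertices by the forest's components.
  record State : Set where
    constructor state
    field
      seen forest : ESet m
      comp : Fin n → Fin n
  open State public

  record Invariant (D : ESet m) (s : State) : Set where
    field
      forest⊆seen    : ∀ e → forest s e ≡ true → seen s e ≡ true
      seen-internal  : ∀ e → seen s e ≡ true → comp s (src e) ≡ comp s (tgt e)
      forest-size    : countℕ (forest s) ≡ excess (comp s)
      comp-connected : ∀ u v → comp s u ≡ comp s v → Reach G (forest s) u v
      forest-acyclic : Acyclic G (forest s)
      seen⊆D         : ∀ e → seen s e ≡ true → D e ≡ true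
  open Invariant public

  start : State
  start = state (λ _ → false) (λ _ → false) id

  start-invariant : ∀ D → Invariant D start
  start-invariant D = record
    { forest⊆seen = λ _ ()
    ; seen-internal = λ _ ()
    ; forest-size = ≡.trans (count-none {m}) (≡.sym (excess-id {n}))
    ; comp-connected = λ u v u≡v → subst (Reach G (λ _ → false) u) u≡v here
    ; forest-acyclic = λ _ ()
    ; seen⊆D = λ _ () }

  data Step (s : State) (e : Fin m) : State → Set where
    skip  : comp s (src e) ≡ comp s (tgt e) →
            Step s e (state (insert e (seen s)) (forest s) (comp s))
    merge : comp s (src e) ≢ comp s (tgt e) →
            Step s e (state (insert e (seen s)) (insert e (forest s)) (relabel (comp s (src e)) (comp s (tgt e)) ∘ comp s))

  step-exists : ∀ s e → Σ State (Step s e)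
  step-exists s e with comp s (src e) ≟ comp s (tgt e)
  ... | yes same = _ , skip same
  ... | no different = _ , merge different

  step-seen : ∀ {s e s'} → Step s e s' → seen s' ≡ insert e (seen s)
  step-seen (skip _) = refl
  step-seen (merge _) = refl

  unseen-not-in-forest : ∀ {D s e} → Invariant D s → seen s e ≡ false → forest s e ≡ false
  unseen-not-in-forest {s = s} {e} inv unseen with forest s e in in-forest
  ... | false = refl
  ... | true = false≢true (≡.trans (≡.sym unseen) (forest⊆seen inv e in-forest))

  module _ {D : ESet m} {s : State} {e : Fin m} (inv : Invariant D s) (De : D e ≡ true) where
    private
      seen⊆D-insert : ∀ g → insert e (seen s) g ≡ true → D g ≡ true
      seen⊆D-insert g g∈ with insert-cases e (seen s) g g∈
      ... | inj₁ refl = De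
      ... | inj₂ seen-g = seen⊆D inv g seen-g

    skip-preserves : (same : comp s (src e) ≡ comp s (tgt e)) → Invariant D (state (insert e (seen s)) (forest s) (comp s))
    skip-preserves same = record
      { forest⊆seen = λ g g∈ → insert-⊇ e (seen s) g (forest⊆seen inv g g∈)
      ; seen-internal = internal
      ; forest-size = forest-size inv
      ; comp-connected = comp-connected inv
      ; forest-acyclic = forest-acyclic inv
      ; seen⊆D = seen⊆D-insert }
      where
      internal : ∀ g → insert e (seen s) g ≡ true → comp s (src g) ≡ comp s (tgt g)
      internal g g∈ with insert-cases e (seen s) g g∈
      ... | inj₁ refl = same
      ... | inj₂ seen-g = seen-internal inv g seen-g

    merge-preserves : seen s e ≡ false → (different : comp s (src e) ≢ comp s (tgt e)) →
      Invariant D (state (insert e (seen s)) (insert e (forest s)) (relabel (comp s (src e)) (comp s (tgt e)) ∘ comp s))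
    merge-preserves unseen different = record
      { forest⊆seen = forest⊆seen'
      ; seen-internal = internal
      ; forest-size = ≡.trans (count-insert-new e (forest s) (unseen-not-in-forest inv unseen))
                        (≡.trans (cong suc (forest-size inv))
                        (≡.sym (excess-merge ℓ a b different (count-pos _ (src e) (dec-true (a ≟ a) refl))
                                                              (count-pos _ (tgt e) (dec-true (b ≟ b) refl)))))
      ; comp-connected = connected
      ; forest-acyclic = acyclic-insert (forest s) e ℓ (λ g g∈ → seen-internal inv g (forest⊆seen inv g g∈))
                           different (forest-acyclic inv)
      ; seen⊆D = seen⊆D-insert }
      where
      ℓ : Fin n → Fin n
      ℓ = comp s
      a b : Fin n
      a = ℓ (src e)
      b = ℓ (tgt e)
      F' : ESet m
      F' = insert e (forest s)
      forest⊆seen' : ∀ g → F' g ≡ true → insert e (seen s) g ≡ true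
      forest⊆seen' g g∈ with insert-cases e (forest s) g g∈
      ... | inj₁ refl = insert-self e (seen s)
      ... | inj₂ forest-g = insert-⊇ e (seen s) g (forest⊆seen inv g forest-g)
      internal : ∀ g → insert e (seen s) g ≡ true → relabel a b (ℓ (src g)) ≡ relabel a b (ℓ (tgt g))
      internal g g∈ with insert-cases e (seen s) g g∈
      ... | inj₁ refl = ≡.trans (relabel-a a b) (≡.sym (relabel-b a b))
      ... | inj₂ seen-g = cong (relabel a b) (seen-internal inv g seen-g)
      grow : ∀ {u v} → Reach G (forest s) u v → Reach G F' u v
      grow = Reach-mono (insert-⊇ e (forest s))
      -- the merged component is connected through the new edge e
      connected : ∀ u v → relabel a b (ℓ u) ≡ relabel a b (ℓ v) → Reach G F' u v
      connected u v same with relabel-≡ a b (ℓ u) (ℓ v) same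
      ... | inj₁ ℓu≡ℓv = grow (comp-connected inv u v ℓu≡ℓv)
      ... | inj₂ (inj₁ (ℓu≡b , ℓv≡a)) = Reach-trans (grow (comp-connected inv u (tgt e) ℓu≡b))
             (step e (insert-self e (forest s)) (inj₂ (refl , refl)) (grow (comp-connected inv (src e) v (≡.sym ℓv≡a))))
      ... | inj₂ (inj₂ (ℓu≡a , ℓv≡b)) = Reach-trans (grow (comp-connected inv u (src e) ℓu≡a))
             (step e (insert-self e (forest s)) (inj₁ (refl , refl)) (grow (comp-connected inv (tgt e) v (≡.sym ℓv≡b))))

  step-preserves : ∀ {D s e s'} → Invariant D s → D e ≡ true → seen s e ≡ false → Step s e s' → Invariant D s'
  step-preserves inv De unseen (skip same) = skip-preserves inv De same
  step-preserves inv De unseen (merge different) = merge-preserves inv De unseen different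

  -- Running the algorithm.  A selection rule for an auxiliary invariant Aux
  -- picks, while some edge of D is unseen, an unseen edge of D whose
  -- examination preserves Aux.

  SelectionRule : ∀ {a} → ESet m → (State → Set a) → Set a
  SelectionRule D Aux = ∀ s → Invariant D s → Aux s → ∀ e₀ → D e₀ ≡ true → seen s e₀ ≡ false →
    Σ (Fin m) (λ e → D e ≡ true × seen s e ≡ false × (∀ s' → Step s e s' → Aux s'))

  Finished : ESet m → State → Set
  Finished D s = ∀ e → D e ≡ true → seen s e ≡ true

  unseen : ESet m → State → ESet m
  unseen D s e = D e ∧ not (seen s e)

  unseen-step : ∀ {D s e s'} → D e ≡ true → seen s e ≡ false → Step s e s' →
    countℕ (unseen D s) ≡ suc (countℕ (unseen D s'))
  unseen-step {D} {s} {e} De unseen-e st rewrite step-seen st =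
    count-insert e was-seen is-unseen same
    where
    was-seen : (D e ∧ not (insert e (seen s) e)) ≡ false
    was-seen rewrite insert-self e (seen s) = BoolP.∧-zeroʳ (D e)
    is-unseen : (D e ∧ not (seen s e)) ≡ true
    is-unseen rewrite De | unseen-e = refl
    same : ∀ v → v ≢ e → (D v ∧ not (insert e (seen s) v)) ≡ (D v ∧ not (seen s v))
    same v v≢e rewrite dec-false (v ≟ e) v≢e = refl

  run : ∀ {a} {D : ESet m} {Aux : State → Set a} → SelectionRule D Aux →
    ∀ k s → Invariant D s → Aux s → countℕ (unseen D s) ≡ k →
    Σ State (λ s' → Invariant D s' × Aux s' × Finished D s')
  run {D = D} rule zero s inv aux none-left = s , inv , aux , finished
    where
    finished : Finished D s
    finished e De with count-zero _ none-left e
    ... | not-unseen rewrite De = BoolP.not-injective not-unseen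
  run {D = D} rule (suc k) s inv aux count≡ with count-witness (unseen D s) count≡
  ... | e₀ , e₀-unseen with rule s inv aux e₀ (BoolP.∧-conicalˡ _ _ e₀-unseen)
                                  (BoolP.not-injective (BoolP.∧-conicalʳ (D e₀) _ e₀-unseen))
  ...   | e , De , unseen-e , aux-preserved with step-exists s e
  ...     | s' , st = run rule k s' (step-preserves inv De unseen-e st) (aux-preserved s' st)
                        (ℕP.suc-injective (≡.trans (≡.sym (unseen-step De unseen-e st)) count≡))

  kruskal : ∀ {a} {D : ESet m} {Aux : State → Set a} → SelectionRule D Aux → Aux start →
    Σ State (λ s → Invariant D s × Aux s × Finished D s)
  kruskal {D = D} rule aux₀ = run rule _ start (start-invariant D) aux₀ refl

  kruskal-any : ∀ (D : ESet m) → Σ State (λ s → Invariant D s × Finished D s)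
  kruskal-any D with kruskal {Aux = λ _ → ⊤} (λ s _ _ e₀ De₀ unseen → e₀ , De₀ , unseen , λ _ _ → tt) tt
  ... | s , inv , _ , finished = s , inv , finished

  forest≡D : ∀ {D X s} → (∀ e → D e ≡ true → X e ≡ true) → Acyclic G X → Invariant D s → Finished D s →
    ∀ e → forest s e ≡ D e
  forest≡D {D} {X} {s} D⊆X acyclic inv finished e with forest s e in in-forest
  ... | true = ≡.sym (seen⊆D inv e (forest⊆seen inv e in-forest))
  ... | false with D e in De
  ...   | false = refl
  ...   | true = ⊥-elim (acyclic e (D⊆X e De) (Reach-mono forest⊆X−e
                  (comp-connected inv _ _ (seen-internal inv e (finished e De)))))
    where
    forest⊆X−e : ∀ g → forest s g ≡ true → removeEdge G X e g ≡ true
    forest⊆X−e g in-forest-g with g ≟ e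
    ... | yes refl = false≢true (≡.trans (≡.sym in-forest) in-forest-g)
    ... | no _ = D⊆X g (seen⊆D inv g (forest⊆seen inv g in-forest-g))

module SpanningTrees {n m : ℕ} (G : Graph n m) where
  open Counting
  open Labellings
  open Kruskal G

  tree-size : 1 Nat.≤ n → ∀ X → IsSpanningTree G X → countℕ X ≡ n ∸ 1
  tree-size 1≤n X (connects , acyclic) with kruskal-any X
  ... | s , inv , finished = begin
    countℕ X          ≡⟨ count-cong (λ e → ≡.sym (forest≡D (λ _ Xe → Xe) acyclic inv finished e)) ⟩
    countℕ (forest s) ≡⟨ forest-size inv ⟩
    excess (comp s)   ≡⟨ excess-const (comp s) (comp s v₀) (λ v → ≡.sym (label-constant (comp s) internal (connects v₀ v))) ⟩
    n ∸ 1             ∎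
    where
    open ≡.≡-Reasoning
    v₀ : Fin n
    v₀ = Data.Fin.fromℕ< 1≤n
    internal : ∀ e → X e ≡ true → comp s (src e) ≡ comp s (tgt e)
    internal e Xe = seen-internal inv e (finished e Xe)

  forest-subtour : ∀ X → Acyclic G X → ∀ (U : VSet n) → NonEmpty U →
    countℕ (λ e → edgesIn G U e ∧ X e) Nat.≤ countℕ U ∸ 1
  forest-subtour X acyclic U (u₀ , Uu₀) with kruskal-any (λ e → edgesIn G U e ∧ X e)
  ... | s , inv , finished = begin
    countℕ (λ e → edgesIn G U e ∧ X e) ≡⟨ count-cong (λ e → ≡.sym (forest≡D D⊆X acyclic inv finished e)) ⟩
    countℕ (forest s)                  ≡⟨ forest-size inv ⟩
    excess (comp s)                    ≤⟨ excess-≤ (comp s) U u₀ Uu₀ outside-alone ⟩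
    countℕ U ∸ 1                       ∎
    where
    open ℕP.≤-Reasoning
    D⊆X : ∀ e → (edgesIn G U e ∧ X e) ≡ true → X e ≡ true
    D⊆X e = BoolP.∧-conicalʳ (edgesIn G U e) (X e)
    forest⊆E[U] : ∀ e → forest s e ≡ true → edgesIn G U e ≡ true
    forest⊆E[U] e in-forest = BoolP.∧-conicalˡ _ _ (seen⊆D inv e (forest⊆seen inv e in-forest))
    outside-alone : ∀ v → U v ≡ false → ∀ u → comp s u ≡ comp s v → u ≡ v
    outside-alone v Uv u same = ≡.sym (walk-from-outside {U = U} forest⊆E[U] Uv (comp-connected inv v u (≡.sym same)))

module TreePolytope {c l : Level} (𝔽 : OrderedField c l) {n m : ℕ} (G : Graph n m) where
  open OrderedFieldProperties 𝔽
  open Solver using (solve; _⊜_; _⊕_; _⊗_)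
  open Counting
  open Labellings
  open Kruskal G
  open SpanningTrees G

  indicator-feasible : Connected G → ∀ T → IsSpanningTree G T → TreeConstraints 𝔽 G (indicator 𝔽 T)
  indicator-feasible (1≤n , _) T (connects , acyclic) =
    trans (sumF-indicator T) (≡⇒≈ (cong (fromℕ 𝔽) (tree-size 1≤n T (connects , acyclic)))) ,
    λ U nonempty → ≤-respˡ (sym (inside U)) (fromℕ-mono (forest-subtour T acyclic U nonempty))
    where
    inside : ∀ U → sumOver 𝔽 (edgesIn G U) (indicator 𝔽 T) ≈ fromℕ 𝔽 (countℕ (λ e → edgesIn G U e ∧ T e))
    inside U = trans (sumF-cong pointwise) (sumF-indicator (λ e → edgesIn G U e ∧ T e))
      where
      pointwise : ∀ e → (if edgesIn G U e then indicator 𝔽 T e else 0#) ≈ indicator 𝔽 (λ e → edgesIn G U e ∧ T e) e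
      pointwise e with edgesIn G U e
      ... | true = ≈-refl
      ... | false = ≈-refl

  indicator-nonneg : ∀ (S : ESet m) e → 0# ≤ indicator 𝔽 S e
  indicator-nonneg S e with S e
  ... | true = 0≤1
  ... | false = ≤-refl

  module _ (x : Fin m → Carrier) (x-feasible : TreeConstraints 𝔽 G x) (x≥0 : ∀ e → 0# ≤ x e) where

    -- The edges inside the classes of a labelling carry at most its excess:
    -- the class of j contributes at most classSize − 1 by the subtour constraint.
    internal-bound : ∀ (ℓ : Fin n → Fin n) (S : ESet m) → (∀ e → S e ≡ true → ℓ (src e) ≡ ℓ (tgt e)) →
      sumOver 𝔽 S x ≤ fromℕ 𝔽 (excess ℓ)
    internal-bound ℓ S S-internal = begin
      sumOver 𝔽 S x                                ≤⟨ sumF-mono S⊆internal ⟩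
      ΣF x-internal                                ≈⟨ sumF-cong (λ e → sumF-only (ℓ (src e)) (λ _ → x-internal e)) ⟨
      ΣF (λ e → ΣF (λ j → in-class j e))           ≈⟨ sumF-cong (λ e → sumF-cong (λ j → by-class e j)) ⟨
      ΣF (λ e → ΣF (λ j → x-in-class j e))         ≈⟨ sumF-swap (λ e j → x-in-class j e) ⟩
      ΣF (λ j → sumOver 𝔽 (edgesIn G (class j)) x) ≤⟨ sumF-mono class-bound ⟩
      ΣF (λ j → fromℕ 𝔽 (classSize ℓ j ∸ 1))       ≈⟨ sumF-fromℕ (λ j → classSize ℓ j ∸ 1) ⟩
      fromℕ 𝔽 (excess ℓ)                           ∎
      where
      open ≤-Reasoning poset
      class : Fin n → VSet n
      class j v = does (ℓ v ≟ j)
      internal : Fin m → Bool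
      internal e = does (ℓ (src e) ≟ ℓ (tgt e))
      x-internal : Fin m → Carrier
      x-internal e = if internal e then x e else 0#
      x-in-class : Fin n → Fin m → Carrier
      x-in-class j e = if edgesIn G (class j) e then x e else 0#
      in-class : Fin n → Fin m → Carrier
      in-class j e = if does (j ≟ ℓ (src e)) then x-internal e else 0#
      S⊆internal : ∀ e → (if S e then x e else 0#) ≤ x-internal e
      S⊆internal e with S e in Se
      ... | true rewrite dec-true (ℓ (src e) ≟ ℓ (tgt e)) (S-internal e Se) = ≤-refl
      ... | false with internal e
      ...   | true = x≥0 e
      ...   | false = ≤-refl
      -- an internal edge lies in exactly the class of its source
      by-class : ∀ e j → x-in-class j e ≈ in-class j e
      by-class e j with j ≟ ℓ (src e)
      ... | no j≢ rewrite dec-false (ℓ (src e) ≟ j) (j≢ ∘ ≡.sym) = ≈-refl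
      ... | yes refl rewrite dec-true (ℓ (src e) ≟ ℓ (src e)) refl with ℓ (src e) ≟ ℓ (tgt e)
      ...   | yes same rewrite dec-true (ℓ (tgt e) ≟ ℓ (src e)) (≡.sym same) = ≈-refl
      ...   | no different rewrite dec-false (ℓ (tgt e) ≟ ℓ (src e)) (different ∘ ≡.sym) = ≈-refl
      class-bound : ∀ j → sumOver 𝔽 (edgesIn G (class j)) x ≤ fromℕ 𝔽 (classSize ℓ j ∸ 1)
      class-bound j with FinP.any? (λ v → ℓ v ≟ j)
      ... | yes (v , ℓv≡j) = proj₂ x-feasible (class j) (v , dec-true (ℓ v ≟ j) ℓv≡j)
      ... | no empty = ≤-respˡ (sym (sumF-zero no-edges)) (0≤fromℕ (classSize ℓ j ∸ 1))
        where
        no-edges : ∀ e → x-in-class j e ≈ 0#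
        no-edges e rewrite dec-false (ℓ (src e) ≟ j) (λ ℓsrc≡j → empty (src e , ℓsrc≡j)) = ≈-refl

    -- Kruskal's algorithm examining the edges by increasing weight w yields a
    -- spanning tree T with w(T) ≤ w · x.  The invariant compares the forest
    -- with x on the edges seen so far.
    module Greedy (w : Fin m → Carrier) where
      weight mass cost size : State → Carrier
      weight s = sumOver 𝔽 (forest s) w
      mass s = sumOver 𝔽 (seen s) x
      cost s = sumOver 𝔽 (seen s) (λ e → w e * x e)
      size s = fromℕ 𝔽 (countℕ (forest s))

      Sorted : State → Set l
      Sorted s = ∀ p q → seen s p ≡ true → seen s q ≡ false → w p ≤ w q

      BoundAt : Carrier → State → Set l
      BoundAt M s = (weight s + (M * mass s)) ≤ (cost s + (M * size s))

      Bound : State → Set (c ⊔ l)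
      Bound s = ∀ M → (∀ e → seen s e ≡ true → w e ≤ M) → BoundAt M s

      Increasing : State → Set (c ⊔ l)
      Increasing s = Sorted s × Bound s

      All : ESet m
      All _ = true

      -- x puts no more mass on the seen edges than the forest has edges,
      -- since the seen edges are internal to the forest's components
      mass≤size : ∀ {s} → Invariant All s → mass s ≤ size s
      mass≤size {s} inv = subst (λ k → mass s ≤ fromℕ 𝔽 k) (≡.sym (forest-size inv))
                            (internal-bound (comp s) (seen s) (seen-internal inv))

      step-bound : ∀ {s e s'} → Invariant All s → seen s e ≡ false → Step s e s' → BoundAt (w e) s → BoundAt (w e) s'
      step-bound {s} {e} inv unseen (skip _) bound = ≤-respˡ (sym lhs) (≤-respʳ rhs (+-monoʳ-≤ (w e * x e) bound))
        where
        lhs : (weight s + (w e * sumOver 𝔽 (insert e (seen s)) x)) ≈ ((weight s + (w e * mass s)) + (w e * x e))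
        lhs = trans (+-congˡ (*-congˡ (sumOver-insert e (seen s) x unseen)))
          (solve 4 (λ A k X y → (A ⊕ (k ⊗ (X ⊕ y))) ⊜ ((A ⊕ (k ⊗ X)) ⊕ (k ⊗ y))) ≈-refl (weight s) (w e) (mass s) (x e))
        rhs : ((cost s + (w e * size s)) + (w e * x e)) ≈ (sumOver 𝔽 (insert e (seen s)) (λ e → w e * x e) + (w e * size s))
        rhs = trans (solve 3 (λ B Y Z → ((B ⊕ Y) ⊕ Z) ⊜ ((B ⊕ Z) ⊕ Y)) ≈-refl (cost s) (w e * size s) (w e * x e))
          (+-congʳ (sym (sumOver-insert e (seen s) _ unseen)))
      step-bound {s} {e} inv unseen (merge _) bound = ≤-respˡ (sym lhs) (≤-respʳ rhs (+-monoʳ-≤ (w e + (w e * x e)) bound))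
        where
        not-in-forest : forest s e ≡ false
        not-in-forest = unseen-not-in-forest inv unseen
        lhs : (sumOver 𝔽 (insert e (forest s)) w + (w e * sumOver 𝔽 (insert e (seen s)) x))
              ≈ ((weight s + (w e * mass s)) + (w e + (w e * x e)))
        lhs = trans (+-cong (sumOver-insert e (forest s) w not-in-forest) (*-congˡ (sumOver-insert e (seen s) x unseen)))
          (solve 4 (λ A k X y → ((A ⊕ k) ⊕ (k ⊗ (X ⊕ y))) ⊜ ((A ⊕ (k ⊗ X)) ⊕ (k ⊕ (k ⊗ y)))) ≈-refl (weight s) (w e) (mass s) (x e))
        rhs : ((cost s + (w e * size s)) + (w e + (w e * x e)))
              ≈ (sumOver 𝔽 (insert e (seen s)) (λ e → w e * x e) + (w e * fromℕ 𝔽 (countℕ (insert e (forest s)))))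
        rhs = trans (+-congˡ (+-congʳ (sym (*-identityʳ (w e)))))
          (trans (solve 5 (λ B k K y o → ((B ⊕ (k ⊗ K)) ⊕ ((k ⊗ o) ⊕ (k ⊗ y))) ⊜ ((B ⊕ (k ⊗ y)) ⊕ (k ⊗ (o ⊕ K))))
                          ≈-refl (cost s) (w e) (size s) (x e) 1#)
          (+-cong (sym (sumOver-insert e (seen s) _ unseen))
                  (*-congˡ (sym (≡⇒≈ (cong (fromℕ 𝔽) (count-insert-new e (forest s) not-in-forest)))))))

      bound-preserved : ∀ {s e s'} → Invariant All s → seen s e ≡ false → Sorted s → Bound s → Step s e s' → Bound s'
      bound-preserved {s} {e} {s'} inv unseen sorted bound st M dominates =
        raise-multiplier _ _ (w e) (mass s') (size s') M
          (step-bound inv unseen st (bound (w e) (λ p seen-p → sorted p e seen-p unseen)))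
          (mass≤size (step-preserves inv refl unseen st))
          (dominates e (subst (λ S → S e ≡ true) (≡.sym (step-seen st)) (insert-self e (seen s))))

      lightest-first : SelectionRule All Increasing
      lightest-first s inv (sorted , bound) e₀ _ e₀-unseen with minimum-on w (λ e → not (seen s e))
      ... | inj₁ none = false≢true (≡.trans (≡.sym e₀-unseen) (BoolP.not-injective (none e₀)))
      ... | inj₂ (e , not-seen-e , lightest) =
        e , refl , e-unseen , λ s' st → sorted' s' st , bound-preserved inv e-unseen sorted bound st
        where
        e-unseen : seen s e ≡ false
        e-unseen = BoolP.not-injective not-seen-e
        sorted-after : ∀ p q → insert e (seen s) p ≡ true → insert e (seen s) q ≡ false → w p ≤ w q
        sorted-after p q seen-p seen-q with insert-cases e (seen s) p seen-p
        ... | inj₁ refl = lightest q (cong not (insert-absent e (seen s) q seen-q))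
        ... | inj₂ seen-p-before = sorted p q seen-p-before (insert-absent e (seen s) q seen-q)
        sorted' : ∀ s' → Step s e s' → Sorted s'
        sorted' s' st p q seen'-p seen'-q =
          sorted-after p q (subst (λ S → S p ≡ true) (step-seen st) seen'-p) (subst (λ S → S q ≡ false) (step-seen st) seen'-q)

      start-increasing : Increasing start
      start-increasing = (λ _ _ ()) , λ M _ → ≤-reflexive (trans (vanishes (sumOver-empty w) (sumOver-empty x))
                                                      (sym (vanishes (sumOver-empty (λ e → w e * x e)) (≡⇒≈ (cong (fromℕ 𝔽) (count-none {m}))))))
        where
        vanishes : ∀ {M a b} → a ≈ 0# → b ≈ 0# → (a + (M * b)) ≈ 0#
        vanishes {M} a≈0 b≈0 = trans (+-cong a≈0 (trans (*-congˡ b≈0) (zeroʳ M))) (+-identityˡ 0#)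

      -- At the end all edges are seen, the forest is a spanning tree with
      -- n − 1 edges, and x has total mass n − 1; cancelling M (n − 1) from
      -- the bound leaves w(T) ≤ w · x.
      greedy-tree : Connected G → Σ (ESet m) (λ T → IsSpanningTree G T × (sumOver 𝔽 T w ≤ ΣF (λ e → w e * x e)))
      greedy-tree (1≤n , connected) with kruskal lightest-first start-increasing
      ... | s , inv , (_ , bound) , finished = forest s , tree , cheaper
        where
        all-seen : ∀ e → seen s e ≡ true
        all-seen e = finished e refl
        v₀ : Fin n
        v₀ = Data.Fin.fromℕ< 1≤n
        same-comp : ∀ v → comp s v₀ ≡ comp s v
        same-comp v = label-constant (comp s) (λ e _ → seen-internal inv e (all-seen e)) (connected v₀ v)
        tree : IsSpanningTree G (forest s)
        tree = (λ u v → comp-connected inv u v (≡.trans (≡.sym (same-comp u)) (same-comp v))) , forest-acyclic inv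
        mass≈size : mass s ≈ size s
        mass≈size = trans (sumOver-full (seen s) x all-seen)
          (trans (proj₁ x-feasible) (≡⇒≈ (cong (fromℕ 𝔽) (≡.sym (tree-size 1≤n (forest s) tree)))))
        M : Carrier
        M = proj₁ (upper-bound w)
        cheaper : weight s ≤ ΣF (λ e → w e * x e)
        cheaper = ≤-respʳ (sumOver-full (seen s) _ all-seen)
          (+-cancelʳ-≤ (M * size s) (≤-respˡ (+-congˡ (*-congˡ mass≈size)) (bound M (λ e _ → proj₂ (upper-bound w) e))))

  mst-≤-polytope : Connected G → ∀ {w X} → IsMST 𝔽 G w X →
    ∀ x → TreeConstraints 𝔽 G x → (∀ e → 0# ≤ x e) → sumOver 𝔽 X w ≤ ΣF (λ e → w e * x e)
  mst-≤-polytope connected {w} (_ , minimal) x x-feasible x≥0 with Greedy.greedy-tree x x-feasible x≥0 w connected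
  ... | T , T-tree , T≤x = ≤-trans (minimal T T-tree) T≤x

-- Replacing θ z in the objective by α x + β y, with
-- α + β = θ and α, β ≥ 0, gives a Lagrangian relaxation whose value never
-- exceeds the objective on feasible points, and which splits into two
-- spanning tree problems with costs C − α and c' − β.
module Lagrangian {c l : Level} (𝔽 : OrderedField c l) {n m : ℕ} (G : Graph n m)
                  (C c' : Fin m → OrderedField.Carrier 𝔽) (θ : OrderedField.Carrier 𝔽) (L : ℕ) where
  open OrderedFieldProperties 𝔽
  open Solver using (solve; _⊜_; _⊕_; _⊗_; ⊝_)
  open TreePolytope 𝔽 G

  pair-feasible : Connected G → ∀ {X Y} → IsSpanningTree G X → IsSpanningTree G Y →
    Feasible 𝔽 G (indicator 𝔽 X) (indicator 𝔽 Y) (indicator 𝔽 (λ e → X e ∧ Y e))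
  pair-feasible connected {X} {Y} X-tree Y-tree =
    indicator-feasible connected X X-tree , indicator-feasible connected Y Y-tree ,
    (λ e → x≤y⇒0≤y−x (both≤X e)) , (λ e → x≤y⇒0≤y−x (both≤Y e)) ,
    indicator-nonneg X , indicator-nonneg Y , indicator-nonneg (λ e → X e ∧ Y e)
    where
    both≤X : ∀ e → indicator 𝔽 (λ e → X e ∧ Y e) e ≤ indicator 𝔽 X e
    both≤X e with X e | Y e
    ... | true | true = ≤-refl
    ... | true | false = 0≤1
    ... | false | _ = ≤-refl
    both≤Y : ∀ e → indicator 𝔽 (λ e → X e ∧ Y e) e ≤ indicator 𝔽 Y e
    both≤Y e with X e | Y e
    ... | true | true = ≤-refl
    ... | true | false = ≤-refl
    ... | false | true = 0≤1
    ... | false | false = ≤-refl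

  objective-term : (x y z : Fin m → Carrier) → Fin m → Carrier
  objective-term x y z e = ((C e * x e) + (c' e * y e)) + (- (θ * z e))

  objective-≈-sum : ∀ x y z → objective 𝔽 G C c' θ L x y z ≈ (ΣF (objective-term x y z) + (θ * fromℕ 𝔽 L))
  objective-≈-sum x y z = +-congʳ (sym (begin
    ΣF (objective-term x y z)
      ≈⟨ sumF-+ (λ e → (C e * x e) + (c' e * y e)) (λ e → - (θ * z e)) ⟩
    ΣF (λ e → (C e * x e) + (c' e * y e)) + ΣF (λ e → - (θ * z e))
      ≈⟨ +-cong (sumF-+ (λ e → C e * x e) (λ e → c' e * y e)) (sumF-neg (λ e → θ * z e)) ⟩
    (ΣF (λ e → C e * x e) + ΣF (λ e → c' e * y e)) − ΣF (λ e → θ * z e)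
      ≈⟨ +-congˡ (-‿cong (sumF-scale θ z)) ⟩
    (ΣF (λ e → C e * x e) + ΣF (λ e → c' e * y e)) − (θ * ΣF z) ∎))
    where open ≈-Reasoning setoid

  module Multipliers (α β : Fin m → Carrier) (α≥0 : ∀ e → 0# ≤ α e) (β≥0 : ∀ e → 0# ≤ β e)
                     (α+β≈θ : ∀ e → (α e + β e) ≈ θ) where
    lagrangian-term : (x y : Fin m → Carrier) → Fin m → Carrier
    lagrangian-term x y e = ((C e − α e) * x e) + ((c' e − β e) * y e)

    lagrangian-term-≈ : ∀ x y e →
      lagrangian-term x y e ≈ (((C e * x e) + (c' e * y e)) + (- ((α e * x e) + (β e * y e))))
    lagrangian-term-≈ x y e =
      trans (+-cong (distrib-− (C e) (α e) (x e)) (distrib-− (c' e) (β e) (y e)))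
        (trans (solve 4 (λ P Q N₁ N₂ → ((P ⊕ N₁) ⊕ (Q ⊕ N₂)) ⊜ ((P ⊕ Q) ⊕ (N₁ ⊕ N₂))) ≈-refl
                        (C e * x e) (c' e * y e) (- (α e * x e)) (- (β e * y e)))
               (+-congˡ (solve 2 (λ a b → ((⊝ a) ⊕ (⊝ b)) ⊜ (⊝ (a ⊕ b))) ≈-refl (α e * x e) (β e * y e))))
      where
      distrib-− : ∀ u v w → ((u − v) * w) ≈ ((u * w) + (- (v * w)))
      distrib-− u v w = trans (distribʳ w u (- v)) (+-congˡ (sym (-‿distribˡ-* v w)))

    multiplier-bound : ∀ (x y z : Fin m → Carrier) e → z e ≤ x e → z e ≤ y e →
      (θ * z e) ≤ ((α e * x e) + (β e * y e))
    multiplier-bound x y z e z≤x z≤y =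
      ≤-respˡ (sym (trans (*-congʳ (sym (α+β≈θ e))) (distribʳ (z e) (α e) (β e))))
              (+-mono-≤ (*-monoˡ-≤ (α≥0 e) z≤x) (*-monoˡ-≤ (β≥0 e) z≤y))

    lagrangian-≤-objective : ∀ x y z e → (θ * z e) ≤ ((α e * x e) + (β e * y e)) →
      lagrangian-term x y e ≤ objective-term x y z e
    lagrangian-≤-objective x y z e bound =
      ≤-respˡ (sym (lagrangian-term-≈ x y e)) (+-monoˡ-≤ _ (-‿antitone bound))

    lagrangian-≈-objective : ∀ x y z e → (θ * z e) ≈ ((α e * x e) + (β e * y e)) →
      lagrangian-term x y e ≈ objective-term x y z e
    lagrangian-≈-objective x y z e exact = trans (lagrangian-term-≈ x y e) (+-congˡ (-‿cong (sym exact)))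

    pair-exact : ∀ {X Y : ESet m} → (∀ e → X e ≡ true → Y e ≡ false → α e ≈ 0#) →
      (∀ e → Y e ≡ true → X e ≡ false → β e ≈ 0#) → ∀ e →
      (θ * indicator 𝔽 (λ e → X e ∧ Y e) e) ≈ ((α e * indicator 𝔽 X e) + (β e * indicator 𝔽 Y e))
    pair-exact {X} {Y} only-X only-Y e with X e in Xe | Y e in Ye
    ... | true | true = trans (*-identityʳ θ) (trans (sym (α+β≈θ e)) (sym (+-cong (*-identityʳ (α e)) (*-identityʳ (β e)))))
    ... | true | false = trans (zeroʳ θ) (sym (trans (+-cong (*-identityʳ (α e)) (zeroʳ (β e)))
                                                    (trans (+-identityʳ (α e)) (only-X e Xe Ye))))
    ... | false | true = trans (zeroʳ θ) (sym (trans (+-cong (zeroʳ (α e)) (*-identityʳ (β e)))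
                                                    (trans (+-identityˡ (β e)) (only-Y e Ye Xe))))
    ... | false | false = trans (zeroʳ θ) (sym (trans (+-cong (zeroʳ (α e)) (zeroʳ (β e))) (+-identityˡ 0#)))

    pair-minimises-lagrangian : Connected G → ∀ {X Y} →
      IsMST 𝔽 G (λ e → C e − α e) X → IsMST 𝔽 G (λ e → c' e − β e) Y →
      ∀ {x y} → TreeConstraints 𝔽 G x → TreeConstraints 𝔽 G y → (∀ e → 0# ≤ x e) → (∀ e → 0# ≤ y e) →
      ΣF (lagrangian-term (indicator 𝔽 X) (indicator 𝔽 Y)) ≤ ΣF (lagrangian-term x y)
    pair-minimises-lagrangian connected {X} {Y} X-mst Y-mst {x} {y} x-tc y-tc x≥0 y≥0 = begin
      ΣF (lagrangian-term (indicator 𝔽 X) (indicator 𝔽 Y))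
        ≈⟨ sumF-+ (λ e → wX e * indicator 𝔽 X e) (λ e → wY e * indicator 𝔽 Y e) ⟩
      ΣF (λ e → wX e * indicator 𝔽 X e) + ΣF (λ e → wY e * indicator 𝔽 Y e)
        ≈⟨ +-cong (sumF-weighted-indicator X wX) (sumF-weighted-indicator Y wY) ⟩
      sumOver 𝔽 X wX + sumOver 𝔽 Y wY
        ≤⟨ +-mono-≤ (mst-≤-polytope connected X-mst x x-tc x≥0) (mst-≤-polytope connected Y-mst y y-tc y≥0) ⟩
      ΣF (λ e → wX e * x e) + ΣF (λ e → wY e * y e)
        ≈⟨ sumF-+ (λ e → wX e * x e) (λ e → wY e * y e) ⟨
      ΣF (lagrangian-term x y) ∎
      where
      open ≤-Reasoning poset
      wX wY : Fin m → Carrier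
      wX e = C e − α e
      wY e = c' e − β e

-- Its value
-- equals the relaxation at (X, Y) (complementary slackness), which is at most
-- the relaxation at any feasible (x, y) (condition (i)), which is at most the
-- objective there.
theorem2 : ∀ {c ℓ} (F : OrderedField c ℓ) {n m : ℕ} (G : Graph n m) → Connected G →
    (k : ℕ) → k Nat.≤ n ∸ 1 →
    let open OrderedField F in
    (C c' : Fin m → Carrier) (θ : Carrier) → 0# ≤ θ →
    (X Y : ESet m) → IsSpanningTree G X → IsSpanningTree G Y →
    (α β : Fin m → Carrier) →
    (∀ e → 0# ≤ α e) → (∀ e → 0# ≤ β e) → (∀ e → (α e + β e) ≈ θ) →
    IsMST F G (λ e → C e − α e) X →
    IsMST F G (λ e → c' e − β e) Y →
    (∀ e → X e ≡ true → Y e ≡ false → α e ≈ 0#) →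
    (∀ e → Y e ≡ true → X e ≡ false → β e ≈ 0#) →
    Optimal F G C c' θ (n ∸ 1 ∸ k) (indicator F X) (indicator F Y) (indicator F (λ e → X e ∧ Y e))
theorem2 F {n} {m} G connected k _ C c' θ _ X Y X-tree Y-tree α β α≥0 β≥0 α+β≈θ X-mst Y-mst only-X only-Y =
  pair-feasible connected X-tree Y-tree , pair-minimal
  where
  open OrderedFieldProperties F
  open Lagrangian F G C c' θ (n ∸ 1 ∸ k)
  open Multipliers α β α≥0 β≥0 α+β≈θ
  iX iY iZ : Fin m → Carrier
  iX = indicator F X
  iY = indicator F Y
  iZ = indicator F (λ e → X e ∧ Y e)
  θL : Carrier
  θL = θ * fromℕ F (n ∸ 1 ∸ k)
  pair-minimal : ∀ x y z → Feasible F G x y z → objective F G C c' θ (n ∸ 1 ∸ k) iX iY iZ ≤ objective F G C c' θ (n ∸ 1 ∸ k) x y z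
  pair-minimal x y z (x-tc , y-tc , 0≤x−z , 0≤y−z , x≥0 , y≥0 , _) = begin
    objective F G C c' θ (n ∸ 1 ∸ k) iX iY iZ ≈⟨ objective-≈-sum iX iY iZ ⟩
    ΣF (objective-term iX iY iZ) + θL
      ≈⟨ +-congʳ (sumF-cong (λ e → lagrangian-≈-objective iX iY iZ e (pair-exact only-X only-Y e))) ⟨
    ΣF (lagrangian-term iX iY) + θL
      ≤⟨ +-monoʳ-≤ θL (pair-minimises-lagrangian connected X-mst Y-mst x-tc y-tc x≥0 y≥0) ⟩
    ΣF (lagrangian-term x y) + θL
      ≤⟨ +-monoʳ-≤ θL (sumF-mono (λ e → lagrangian-≤-objective x y z e
           (multiplier-bound x y z e (0≤y−x⇒x≤y (0≤x−z e)) (0≤y−x⇒x≤y (0≤y−z e))))) ⟩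
    ΣF (objective-term x y z) + θL ≈⟨ objective-≈-sum x y z ⟨
    objective F G C c' θ (n ∸ 1 ∸ k) x y z ∎
    where open ≤-Reasoning poset
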